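{- Let $t,r$ be positive integers, $m=tr$, $n=2m$, and let \[S=\{x\in\mathbb{F}_{2^n}: \mathrm{Tr}_r^m(x^{2^m+1})=0,\ x+x^{2^m}\in\mathbb{F}_{2^r}\}.\] Then $|S|=2^{m-r}$.
   Context: For integers $k\mid \ell$ and $z\in\mathbb{F}_{2^\ell}$, the trace is $\mathrm{Tr}_k^\ell(z)=z+z^{2^k}+z^{2^{2k}}+\cdots+z^{2^{\ell-k}}\in\mathbb{F}_{2^k}$. Here $\mathbb{F}_{2^r}\subseteq\mathbb{F}_{2^m}\subseteq\mathbb{F}_{2^n}$, and $x^{2^m+1}\in\mathbb{F}_{2^m}$ for $x\in\mathbb{F}_{2^n}$. -}

module Defs where

open import Data.Nat as ℕ using (ℕ; zero; suc; _^_)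
open import Data.Fin as Fin using (Fin)
import Data.Fin.Properties as FinP
open import Data.List using (List; length; filter)
open import Data.List.Base using () renaming (map to lmap)
open import Data.Fin.Base using ()
open import Data.Product using (∃; _×_)
open import Relation.Nullary.Decidable using (_×-dec_)
import Level
open import Relation.Nullary using (¬_; Dec; yes; no)
open import Relation.Unary using (Pred; Decidable)
open import Relation.Binary.PropositionalEquality using (_≡_; refl; cong; sym; trans)
open import Function.Bundles using (_↔_; Inverse)
open import Algebra.Structures using (IsCommutativeRing)
open import Data.List.Base using (allFin)

record GF2^ (n : ℕ) : Set₁ where
  infixl 6 _+_
  infixl 7 _*_
  field
    F    : Set
    _+_  : F → F → F
    _*_  : F → F → F
    -_   : F → F
    0#   : F
    1#   : F
    isCommutativeRing : IsCommutativeRing _≡_ _+_ _*_ -_ 0# 1#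
    0≢1  : ¬ (0# ≡ 1#)
    inverse : ∀ x → ¬ (x ≡ 0#) → ∃ λ y → x * y ≡ 1#
    enum : Fin (2 ^ n) ↔ F

  pow : F → ℕ → F
  pow x zero    = 1#
  pow x (suc k) = x * pow x k

  sumF : ℕ → (ℕ → F) → F
  sumF zero    f = 0#
  sumF (suc d) f = sumF d f + f d

  -- Tr_k^ℓ(z) = z + z^{2^k} + ... + z^{2^{ℓ-k}}, where d = ℓ / k is the
  -- number of terms:  Tr k d z = Σ_{i<d} z^{2^{k i}}
  Tr : ℕ → ℕ → F → F
  Tr k d z = sumF d (λ i → pow z (2 ^ (k ℕ.* i)))

  -- membership in the subfield F_{2^k}:  y^{2^k} = y
  InSub : ℕ → F → Set
  InSub k y = pow y (2 ^ k) ≡ y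

  _≟_ : (x y : F) → Dec (x ≡ y)
  x ≟ y with Inverse.from enum x FinP.≟ Inverse.from enum y
  ... | yes p = yes (trans (sym (Inverse.strictlyInverseˡ enum x))
                      (trans (cong (Inverse.to enum) p) (Inverse.strictlyInverseˡ enum y)))
  ... | no ¬p = no (λ q → ¬p (cong (Inverse.from enum) q))

  count : {P : Pred F Level.zero} → Decidable P → ℕ
  count P? = length (filter (λ i → P? (Inverse.to enum i)) (allFin (2 ^ n)))

module _ {n : ℕ} (K : GF2^ n) where
  open GF2^ K

  InS : (t r : ℕ) → F → Set
  InS t r x = (Tr r t (pow x (2 ^ (t ℕ.* r) ℕ.+ 1)) ≡ 0#)
            × InSub r (x + pow x (2 ^ (t ℕ.* r)))

  InS? : (t r : ℕ) → Decidable (InS t r)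
  InS? t r x = (Tr r t (pow x (2 ^ (t ℕ.* r) ℕ.+ 1)) ≟ 0#)
             ×-dec (pow (x + pow x (2 ^ (t ℕ.* r))) (2 ^ r) ≟ (x + pow x (2 ^ (t ℕ.* r))))

{-# OPTIONS --safe #-}
-- Write q = 2^m and T = Tr_r^m.  The record only provides a commutative ring with inverses and
-- 2^n elements, so first: multiplication by a ≠ 0 permutes the field, which gives Fermat's
-- x^(2^n) = x, and (-1)^(2^n) = -1 then forces characteristic 2.
--
-- In characteristic 2 the trace satisfies T(x)^(2^r) + T(x) = x^q + x.  So T(x) = 0 puts x in
-- F_q, where x^(q+1) = x² and T(x²) = T(x)² = 0: the kernel of T lies in S.  Conversely let x ∈ S.
-- If y = x + x^q ≠ 0 then z = x/y has z^q = z + 1, while F_{2^r}-linearity of T gives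
-- T(z² + z) = T(x^(q+1))/y² = 0, whence z^q + z = T(z^(2^r) + z) = Σ_{k<r} T(z² + z)^(2^k) = 0,
-- a contradiction.  Hence x ∈ F_q and T(x)² = T(x^(q+1)) = 0, so S = ker T.
--
-- As a polynomial, T is monic of degree 2^(m-r), which bounds |ker T| from above.  For the lower
-- bound, T · H = ℘(℘(x)) = x^(q²) + x for ℘(x) = x^q + x and a monic H of degree 2^n - 2^(m-r),
-- and it vanishes on all of F_{2^n}, so every element is a root of T or of H.
module Submission where

open import Defs
open import Data.Nat using (ℕ; suc; _*_; _∸_; _^_; _≤_)
open import Relation.Binary.PropositionalEquality using (_≡_)

open import Data.Nat as ℕ using (zero; pred; _<_; z≤n; s≤s)
import Data.Nat.Properties as ℕP
open import Data.Fin as Fin using (Fin; punchIn)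
open import Data.Fin.Properties using (punchInᵢ≢i)
open import Data.Fin.Permutation using (Permutation; permutation)
open import Data.List using (List; []; _∷_; length; filter; allFin)
open import Data.List.Base using () renaming (map to lmap)
import Data.List.Properties as LP
open import Data.List.Relation.Unary.All as All using (All; []; _∷_)
import Data.List.Relation.Unary.All.Properties as AllP
open import Data.List.Relation.Unary.Unique.Propositional using (Unique)
open import Data.List.Relation.Unary.AllPairs using ([]; _∷_)
import Data.List.Relation.Unary.Unique.Propositional.Properties as UniqueP
open import Data.Vec as Vec using (Vec; []; _∷_)
open import Data.Product using (Σ; _×_; _,_; proj₁; proj₂)
open import Data.Sum using (_⊎_; inj₁; inj₂; [_,_])
open import Data.Empty using (⊥-elim)
open import Data.Maybe using (nothing)
open import Function using (id; _∘_)
open import Function.Bundles using (Inverse)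
open import Level using (0ℓ)
open import Relation.Nullary using (yes; no)
open import Relation.Unary using (Pred; Decidable; _⊆_)
open import Relation.Binary.PropositionalEquality
  using (_≢_; refl; sym; trans; cong; cong₂; subst; module ≡-Reasoning)
open import Algebra.Structures using (IsCommutativeRing)
open import Algebra.Bundles using (CommutativeRing)
import Algebra.Properties.CommutativeMonoid.Sum as MonoidSum
import Algebra.Properties.CommutativeSemiring.Exp as SemiringExp
import Algebra.Properties.Ring as RingProperties
open import Tactic.RingSolver.Core.AlmostCommutativeRing using (fromCommutativeRing)

length≤filter+filter : ∀ {A : Set} {P Q : Pred A 0ℓ} (P? : Decidable P) (Q? : Decidable Q) →
                       (∀ x → P x ⊎ Q x) →
                       ∀ xs → length xs ≤ length (filter P? xs) ℕ.+ length (filter Q? xs)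
length≤filter+filter P? Q? P∪Q [] = z≤n
length≤filter+filter P? Q? P∪Q (x ∷ xs) with P? x | Q? x | length≤filter+filter P? Q? P∪Q xs
... | yes _ | yes _ | ih = s≤s (ℕP.≤-trans ih (ℕP.+-monoʳ-≤ (length (filter P? xs)) (ℕP.n≤1+n _)))
... | yes _ | no  _ | ih = s≤s ih
... | no  _ | yes _ | ih = subst (suc (length xs) ≤_) (sym (ℕP.+-suc _ _)) (s≤s ih)
... | no ¬p | no ¬q | _  = ⊥-elim ([ ¬p , ¬q ] (P∪Q x))

1≤pred[2^k] : ∀ {k} → 0 < k → 1 ≤ pred (2 ^ k)
1≤pred[2^k] 0<k = ℕP.pred-mono-≤ (ℕP.^-monoʳ-≤ 2 0<k)

module FiniteField {n : ℕ} (K : GF2^ n) where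
  open GF2^ K renaming (_*_ to _·_)
  open IsCommutativeRing isCommutativeRing
    using (+-assoc; +-comm; +-identityˡ; +-identityʳ; -‿inverseˡ; -‿inverseʳ;
           *-assoc; *-comm; *-identityˡ; *-identityʳ; distribˡ; distribʳ; zeroˡ; zeroʳ)

  commutativeRing : CommutativeRing 0ℓ 0ℓ
  commutativeRing = record { isCommutativeRing = isCommutativeRing }

  open SemiringExp (CommutativeRing.commutativeSemiring commutativeRing)
    using (^-homo-*; ^-assocʳ; ^-distrib-*) renaming (_^_ to _^ᴷ_)
  open RingProperties (CommutativeRing.ring commutativeRing) using (-1*x≈-x; -‿involutive; x∙y⁻¹≈ε⇒x≈y)
  open import Tactic.RingSolver.NonReflective (fromCommutativeRing commutativeRing (λ _ → nothing))
    using (solve; _⊜_; _⊕_; _⊗_; ⊝_)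
  open ≡-Reasoning

  _-_ : F → F → F
  x - y = x + - y

  e : Fin (2 ^ n) → F
  e = Inverse.to enum

  ι : F → Fin (2 ^ n)
  ι = Inverse.from enum

  e∘ι : ∀ x → e (ι x) ≡ x
  e∘ι = Inverse.strictlyInverseˡ enum

  ι∘e : ∀ i → ι (e i) ≡ i
  ι∘e = Inverse.strictlyInverseʳ enum

  inv : ∀ x → x ≢ 0# → F
  inv x x≢0 = proj₁ (inverse x x≢0)

  ·-inverseʳ : ∀ x (x≢0 : x ≢ 0#) → x · inv x x≢0 ≡ 1#
  ·-inverseʳ x x≢0 = proj₂ (inverse x x≢0)

  ·-inverseˡ : ∀ x (x≢0 : x ≢ 0#) → inv x x≢0 · x ≡ 1#
  ·-inverseˡ x x≢0 = trans (*-comm _ x) (·-inverseʳ x x≢0)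

  ·-cancelʳ : ∀ {x} y z → x ≢ 0# → y · x ≡ z · x → y ≡ z
  ·-cancelʳ {x} y z x≢0 eq = begin
    y                ≡⟨ sym (*-identityʳ y) ⟩
    y · 1#           ≡⟨ cong (y ·_) (sym (·-inverseʳ x x≢0)) ⟩
    y · (x · x⁻¹)    ≡⟨ sym (*-assoc y x x⁻¹) ⟩
    (y · x) · x⁻¹    ≡⟨ cong (_· x⁻¹) eq ⟩
    (z · x) · x⁻¹    ≡⟨ *-assoc z x x⁻¹ ⟩
    z · (x · x⁻¹)    ≡⟨ cong (z ·_) (·-inverseʳ x x≢0) ⟩
    z · 1#           ≡⟨ *-identityʳ z ⟩
    z                ∎
    where x⁻¹ = inv x x≢0

  x·y≡0⇒x≡0⊎y≡0 : ∀ x y → x · y ≡ 0# → x ≡ 0# ⊎ y ≡ 0#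
  x·y≡0⇒x≡0⊎y≡0 x y xy≡0 with x ≟ 0#
  ... | yes x≡0 = inj₁ x≡0
  ... | no  x≢0 = inj₂ (·-cancelʳ y 0# x≢0 (trans (*-comm y x) (trans xy≡0 (sym (zeroˡ x)))))

  ·-nonzero : ∀ {x y} → x ≢ 0# → y ≢ 0# → x · y ≢ 0#
  ·-nonzero x≢0 y≢0 xy≡0 = [ x≢0 , y≢0 ] (x·y≡0⇒x≡0⊎y≡0 _ _ xy≡0)

  pow≗^ : ∀ x k → pow x k ≡ x ^ᴷ k
  pow≗^ x zero    = refl
  pow≗^ x (suc k) = cong (x ·_) (pow≗^ x k)

  pow-+ : ∀ x a b → pow x (a ℕ.+ b) ≡ pow x a · pow x b
  pow-+ x a b rewrite pow≗^ x (a ℕ.+ b) | pow≗^ x a | pow≗^ x b = ^-homo-* x a b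

  pow-* : ∀ x a b → pow x (a ℕ.* b) ≡ pow (pow x a) b
  pow-* x a b rewrite pow≗^ x (a ℕ.* b) | pow≗^ x a | pow≗^ (x ^ᴷ a) b = sym (^-assocʳ x a b)

  pow-distrib-· : ∀ x y k → pow (x · y) k ≡ pow x k · pow y k
  pow-distrib-· x y k rewrite pow≗^ (x · y) k | pow≗^ x k | pow≗^ y k = ^-distrib-* x y k

  pow-identityʳ : ∀ x → pow x 1 ≡ x
  pow-identityʳ = *-identityʳ

  pow-1# : ∀ k → pow 1# k ≡ 1#
  pow-1# zero    = refl
  pow-1# (suc k) = trans (*-identityˡ _) (pow-1# k)

  pow-0# : ∀ {k} → 0 < k → pow 0# k ≡ 0#
  pow-0# {suc k} _ = zeroˡ _

  pow-0#-2^ : ∀ k → pow 0# (2 ^ k) ≡ 0#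
  pow-0#-2^ k = pow-0# (ℕP.m^n>0 2 k)

  pow-comm : ∀ x a b → pow (pow x a) b ≡ pow (pow x b) a
  pow-comm x a b = trans (sym (pow-* x a b)) (trans (cong (pow x) (ℕP.*-comm a b)) (pow-* x b a))

  pow-2^-2^ : ∀ x a b → pow (pow x (2 ^ a)) (2 ^ b) ≡ pow x (2 ^ (a ℕ.+ b))
  pow-2^-2^ x a b = trans (sym (pow-* x (2 ^ a) (2 ^ b))) (cong (pow x) (sym (ℕP.^-distribˡ-+-* 2 a b)))

  pow-2≡0⇒≡0 : ∀ {x} → pow x 2 ≡ 0# → x ≡ 0#
  pow-2≡0⇒≡0 {x} x²≡0 = [ id , id ] (x·y≡0⇒x≡0⊎y≡0 x x (trans (cong (x ·_) (sym (*-identityʳ x))) x²≡0))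

  a·[a^pred[2^k]+1]≡a^2^k+a : ∀ k a → a · (pow a (pred (2 ^ k)) + 1#) ≡ pow a (2 ^ k) + a
  a·[a^pred[2^k]+1]≡a^2^k+a k a =
    trans (distribˡ a _ 1#) (cong₂ _+_ (cong (pow a) (ℕP.suc-pred (2 ^ k) {{ℕP.m^n≢0 2 k}})) (*-identityʳ a))

  InSub-· : ∀ {k a b} → InSub k a → InSub k b → InSub k (a · b)
  InSub-· {k} {a} {b} a∈ b∈ = trans (pow-distrib-· a b (2 ^ k)) (cong₂ _·_ a∈ b∈)

  InSub-inv : ∀ {k y} (y≢0 : y ≢ 0#) → InSub k y → InSub k (inv y y≢0)
  InSub-inv {k} {y} y≢0 y∈ = begin
    pow y⁻¹ Q                  ≡⟨ sym (*-identityˡ _) ⟩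
    1# · pow y⁻¹ Q             ≡⟨ cong (_· pow y⁻¹ Q) (sym (·-inverseˡ y y≢0)) ⟩
    (y⁻¹ · y) · pow y⁻¹ Q      ≡⟨ *-assoc y⁻¹ y _ ⟩
    y⁻¹ · (y · pow y⁻¹ Q)      ≡⟨ cong (λ s → y⁻¹ · (s · pow y⁻¹ Q)) (sym y∈) ⟩
    y⁻¹ · (pow y Q · pow y⁻¹ Q) ≡⟨ cong (y⁻¹ ·_) (sym (pow-distrib-· y y⁻¹ Q)) ⟩
    y⁻¹ · pow (y · y⁻¹) Q      ≡⟨ cong (λ s → y⁻¹ · pow s Q) (·-inverseʳ y y≢0) ⟩
    y⁻¹ · pow 1# Q             ≡⟨ cong (y⁻¹ ·_) (pow-1# Q) ⟩
    y⁻¹ · 1#                   ≡⟨ *-identityʳ y⁻¹ ⟩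
    y⁻¹                        ∎
    where
    y⁻¹ = inv y y≢0
    Q   = 2 ^ k

  InSub-pow-2^-multiple : ∀ {r b} → InSub r b → ∀ i → pow b (2 ^ (r ℕ.* i)) ≡ b
  InSub-pow-2^-multiple {r} {b} b∈ zero = trans (cong (λ k → pow b (2 ^ k)) (ℕP.*-zeroʳ r)) (pow-identityʳ b)
  InSub-pow-2^-multiple {r} {b} b∈ (suc i) = begin
    pow b (2 ^ (r ℕ.* suc i))            ≡⟨ cong (λ k → pow b (2 ^ k)) (ℕP.*-suc r i) ⟩
    pow b (2 ^ (r ℕ.+ r ℕ.* i))          ≡⟨ sym (pow-2^-2^ b r (r ℕ.* i)) ⟩
    pow (pow b (2 ^ r)) (2 ^ (r ℕ.* i))  ≡⟨ cong (λ z → pow z (2 ^ (r ℕ.* i))) b∈ ⟩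
    pow b (2 ^ (r ℕ.* i))                ≡⟨ InSub-pow-2^-multiple {r} b∈ i ⟩
    b                                    ∎

  -- Fermat's little theorem and characteristic two

  module Π = MonoidSum (CommutativeRing.*-commutativeMonoid commutativeRing)

  prod : ∀ {k} → (Fin k → F) → F
  prod = Π.sum

  prod-const : ∀ k a → prod {k} (λ _ → a) ≡ pow a k
  prod-const k a = trans (Π.sum-replicate k) (sym (pow≗^ a k))

  prod-ones : ∀ {k} (f : Fin k → F) → (∀ i → f i ≡ 1#) → prod f ≡ 1#
  prod-ones {k} f f≡1 = trans (Π.sum-cong-≗ f≡1) (Π.sum-replicate-zero k)

  prod-single : ∀ {k} (f : Fin k → F) i → (∀ j → j ≢ i → f j ≡ 1#) → prod f ≡ f i
  prod-single {suc k} f i f≡1 = begin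
    prod f                     ≡⟨ Π.sum-remove {i = i} f ⟩
    f i · prod (f ∘ punchIn i) ≡⟨ cong (f i ·_) (prod-ones _ (λ j → f≡1 _ (punchInᵢ≢i i j))) ⟩
    f i · 1#                   ≡⟨ *-identityʳ (f i) ⟩
    f i                        ∎

  prod-nonzero : ∀ {k} (f : Fin k → F) → (∀ i → f i ≢ 0#) → prod f ≢ 0#
  prod-nonzero {zero}  f f≢0 = 0≢1 ∘ sym
  prod-nonzero {suc k} f f≢0 = ·-nonzero (f≢0 Fin.zero) (prod-nonzero (f ∘ Fin.suc) (f≢0 ∘ Fin.suc))

  ifZero : F → F → F → F
  ifZero x u v with x ≟ 0#
  ... | yes _ = u
  ... | no  _ = v

  ifZero-0# : ∀ u v → ifZero 0# u v ≡ u
  ifZero-0# u v with 0# ≟ 0#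
  ... | yes _   = refl
  ... | no  0≢0 = ⊥-elim (0≢0 refl)

  ifZero-nonzero : ∀ {x} u v → x ≢ 0# → ifZero x u v ≡ v
  ifZero-nonzero {x} u v x≢0 with x ≟ 0#
  ... | yes x≡0 = ⊥-elim (x≢0 x≡0)
  ... | no  _   = refl

  ifZero-· : ∀ x a → ifZero x 1# a · ifZero x a 1# ≡ a
  ifZero-· x a with x ≟ 0#
  ... | yes _ = *-identityˡ a
  ... | no  _ = *-identityʳ a

  nonzeroPart : F → F
  nonzeroPart x = ifZero x 1# x

  nonzeroPart-nonzero : ∀ x → nonzeroPart x ≢ 0#
  nonzeroPart-nonzero x with x ≟ 0#
  ... | yes _   = 0≢1 ∘ sym
  ... | no  x≢0 = x≢0

  nonzeroPart-· : ∀ {a} x → a ≢ 0# → nonzeroPart (a · x) ≡ ifZero x 1# a · nonzeroPart x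
  nonzeroPart-· {a} x a≢0 with x ≟ 0# | (a · x) ≟ 0#
  ... | yes _   | yes _    = sym (*-identityˡ 1#)
  ... | yes x≡0 | no ax≢0  = ⊥-elim (ax≢0 (trans (cong (a ·_) x≡0) (zeroʳ a)))
  ... | no  x≢0 | yes ax≡0 = ⊥-elim (·-nonzero a≢0 x≢0 ax≡0)
  ... | no  _   | no  _    = refl

  ·-permutation : ∀ a → a ≢ 0# → Permutation (2 ^ n) (2 ^ n)
  ·-permutation a a≢0 = permutation (λ i → ι (a · e i)) (λ j → ι (a⁻¹ · e j))
    (cancel a a⁻¹ (·-inverseʳ a a≢0)) (cancel a⁻¹ a (·-inverseˡ a a≢0))
    where
    a⁻¹ = inv a a≢0
    cancel : ∀ b c → b · c ≡ 1# → ∀ i → ι (b · e (ι (c · e i))) ≡ i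
    cancel b c bc≡1 i = begin
      ι (b · e (ι (c · e i)))  ≡⟨ cong (λ z → ι (b · z)) (e∘ι _) ⟩
      ι (b · (c · e i))        ≡⟨ cong ι (sym (*-assoc b c _)) ⟩
      ι ((b · c) · e i)        ≡⟨ cong (λ z → ι (z · e i)) bc≡1 ⟩
      ι (1# · e i)             ≡⟨ cong ι (*-identityˡ _) ⟩
      ι (e i)                  ≡⟨ ι∘e i ⟩
      i                        ∎

  -- Multiplication by a permutes F, so G = ∏ nonzeroPart satisfies G = (∏ ifZero x 1# a) · G.
  prod-ifZero-1#-a : ∀ {a} → a ≢ 0# → prod (λ i → ifZero (e i) 1# a) ≡ 1#
  prod-ifZero-1#-a {a} a≢0 = sym (·-cancelʳ 1# H (prod-nonzero _ (nonzeroPart-nonzero ∘ e)) (begin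
    1# · G                                     ≡⟨ *-identityˡ G ⟩
    G                                          ≡⟨ Π.sum-permute (nonzeroPart ∘ e) (·-permutation a a≢0) ⟩
    prod (λ i → nonzeroPart (e (ι (a · e i)))) ≡⟨ Π.sum-cong-≗ (λ i → cong nonzeroPart (e∘ι (a · e i))) ⟩
    prod (λ i → nonzeroPart (a · e i))         ≡⟨ Π.sum-cong-≗ (λ i → nonzeroPart-· (e i) a≢0) ⟩
    prod (λ i → ifZero (e i) 1# a · nonzeroPart (e i)) ≡⟨ Π.∑-distrib-+ (λ i → ifZero (e i) 1# a) (nonzeroPart ∘ e) ⟩
    H · G                                      ∎))
    where
    G = prod (nonzeroPart ∘ e)
    H = prod (λ i → ifZero (e i) 1# a)

  prod-ifZero-a-1# : ∀ a → prod (λ i → ifZero (e i) a 1#) ≡ a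
  prod-ifZero-a-1# a = trans (prod-single _ (ι 0#) (λ i i≢ι0 → ifZero-nonzero a 1# (i≢ι0 ∘ e≡0⇒≡ι0)))
                             (trans (cong (λ x → ifZero x a 1#) (e∘ι 0#)) (ifZero-0# a 1#))
    where
    e≡0⇒≡ι0 : ∀ {i} → e i ≡ 0# → i ≡ ι 0#
    e≡0⇒≡ι0 {i} eq = trans (sym (ι∘e i)) (cong ι eq)

  fermat : ∀ a → pow a (2 ^ n) ≡ a
  fermat a with a ≟ 0#
  ... | yes refl = pow-0#-2^ n
  ... | no  a≢0  = begin
    pow a (2 ^ n)                                        ≡⟨ sym (prod-const (2 ^ n) a) ⟩
    prod {2 ^ n} (λ _ → a)                               ≡⟨ Π.sum-cong-≗ (λ i → sym (ifZero-· (e i) a)) ⟩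
    prod (λ i → ifZero (e i) 1# a · ifZero (e i) a 1#)   ≡⟨ Π.∑-distrib-+ (λ i → ifZero (e i) 1# a) (λ i → ifZero (e i) a 1#) ⟩
    prod (λ i → ifZero (e i) 1# a) · prod (λ i → ifZero (e i) a 1#) ≡⟨ cong₂ _·_ (prod-ifZero-1#-a a≢0) (prod-ifZero-a-1# a) ⟩
    1# · a                                               ≡⟨ *-identityˡ a ⟩
    a                                                    ∎

  characteristic-two : ∀ {n'} → n ≡ suc n' → 1# + 1# ≡ 0#
  characteristic-two {n'} n≡ = trans (cong (1# +_) 1≡-1) (-‿inverseʳ 1#)
    where
    [-1]²≡1 : pow (- 1#) 2 ≡ 1#
    [-1]²≡1 = trans (cong (- 1# ·_) (*-identityʳ (- 1#))) (trans (-1*x≈-x (- 1#)) (-‿involutive 1#))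
    1≡-1 : 1# ≡ - 1#
    1≡-1 = begin
      1#                           ≡⟨ sym (pow-1# (2 ^ n')) ⟩
      pow 1# (2 ^ n')              ≡⟨ cong (λ z → pow z (2 ^ n')) (sym [-1]²≡1) ⟩
      pow (pow (- 1#) 2) (2 ^ n')  ≡⟨ sym (pow-* (- 1#) 2 (2 ^ n')) ⟩
      pow (- 1#) (2 ^ suc n')      ≡⟨ cong (λ k → pow (- 1#) (2 ^ k)) (sym n≡) ⟩
      pow (- 1#) (2 ^ n)           ≡⟨ fermat (- 1#) ⟩
      - 1#                         ∎

  sumF-cong : ∀ d {f g : ℕ → F} → (∀ i → f i ≡ g i) → sumF d f ≡ sumF d g
  sumF-cong zero    f≗g = refl
  sumF-cong (suc d) f≗g = cong₂ _+_ (sumF-cong d f≗g) (f≗g d)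

  sumF-zero : ∀ d → sumF d (λ _ → 0#) ≡ 0#
  sumF-zero zero    = refl
  sumF-zero (suc d) = trans (+-identityʳ _) (sumF-zero d)

  sumF-distrib-+ : ∀ d (f g : ℕ → F) → sumF d (λ i → f i + g i) ≡ sumF d f + sumF d g
  sumF-distrib-+ zero    f g = sym (+-identityʳ 0#)
  sumF-distrib-+ (suc d) f g = trans (cong (_+ (f d + g d)) (sumF-distrib-+ d f g))
    (solve 4 (λ a b c d → ((a ⊕ b) ⊕ (c ⊕ d)) ⊜ ((a ⊕ c) ⊕ (b ⊕ d))) refl (sumF d f) (sumF d g) (f d) (g d))

  sumF-distribʳ-· : ∀ d (f : ℕ → F) b → sumF d (λ i → f i · b) ≡ sumF d f · b
  sumF-distribʳ-· zero    f b = sym (zeroˡ b)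
  sumF-distribʳ-· (suc d) f b = trans (cong (_+ (f d · b)) (sumF-distribʳ-· d f b)) (sym (distribʳ b _ _))

  -- Polynomial functions and their roots

  horner : ∀ {k} → Vec F k → F → F
  horner []       x = 0#
  horner (c ∷ cs) x = c + x · horner cs x

  -- evaluates the monic polynomial whose coefficients below the leading 1 are the given ones
  hornerMonic : ∀ {k} → Vec F k → F → F
  hornerMonic []       x = 1#
  hornerMonic (c ∷ cs) x = c + x · hornerMonic cs x

  Deg< : ℕ → (F → F) → Set
  Deg< k f = Σ (Vec F k) (λ v → ∀ x → f x ≡ horner v x)

  Monic : ℕ → (F → F) → Set
  Monic k f = Σ (Vec F k) (λ v → ∀ x → f x ≡ hornerMonic v x)

  Monic-ext : ∀ {k f g} → Monic k f → (∀ x → g x ≡ f x) → Monic k g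
  Monic-ext (v , f≗v) g≗f = v , λ x → trans (g≗f x) (f≗v x)

  Deg<-0 : ∀ k → Deg< k (λ _ → 0#)
  Deg<-0 k = Vec.replicate k 0# , λ x → sym (horner-0 k x)
    where
    horner-0 : ∀ k x → horner (Vec.replicate k 0#) x ≡ 0#
    horner-0 zero    x = refl
    horner-0 (suc k) x = trans (+-identityˡ _) (trans (cong (x ·_) (horner-0 k x)) (zeroʳ x))

  Deg<-const : ∀ c → Deg< 1 (λ _ → c)
  Deg<-const c = (c ∷ []) , λ x → sym (trans (cong (c +_) (zeroʳ x)) (+-identityʳ c))

  Deg<-id : Deg< 2 id
  Deg<-id = (0# ∷ 1# ∷ []) , λ x → sym (begin
    0# + x · (1# + x · 0#)  ≡⟨ +-identityˡ _ ⟩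
    x · (1# + x · 0#)       ≡⟨ cong (λ s → x · (1# + s)) (zeroʳ x) ⟩
    x · (1# + 0#)           ≡⟨ cong (x ·_) (+-identityʳ 1#) ⟩
    x · 1#                  ≡⟨ *-identityʳ x ⟩
    x                       ∎)

  Deg<-suc : ∀ {k f} → Deg< k f → Deg< (suc k) f
  Deg<-suc (v , f≗v) = v Vec.∷ʳ 0# , λ x → trans (f≗v x) (sym (horner-∷ʳ-0# v x))
    where
    horner-∷ʳ-0# : ∀ {k} (v : Vec F k) x → horner (v Vec.∷ʳ 0#) x ≡ horner v x
    horner-∷ʳ-0# []       x = trans (+-identityˡ _) (zeroʳ x)
    horner-∷ʳ-0# (c ∷ cs) x = cong (λ s → c + x · s) (horner-∷ʳ-0# cs x)

  Deg<-≤ : ∀ {k k' f} → k ≤ k' → Deg< k f → Deg< k' f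
  Deg<-≤ k≤k' = go (ℕP.≤⇒≤′ k≤k')
    where
    go : ∀ {k k' f} → k ℕ.≤′ k' → Deg< k f → Deg< k' f
    go (ℕ.≤′-reflexive refl) d = d
    go (ℕ.≤′-step k≤′k')     d = Deg<-suc (go k≤′k' d)

  Deg<-scale : ∀ {k g} c → Deg< k g → Deg< k (λ x → c · g x)
  Deg<-scale c (v , g≗v) = Vec.map (c ·_) v , λ x → trans (cong (c ·_) (g≗v x)) (sym (horner-scale v x))
    where
    horner-scale : ∀ {k} (v : Vec F k) x → horner (Vec.map (c ·_) v) x ≡ c · horner v x
    horner-scale []       x = sym (zeroʳ c)
    horner-scale (a ∷ v) x = trans (cong (λ s → c · a + x · s) (horner-scale v x))
      (solve 4 (λ c a x h → (c ⊗ a ⊕ x ⊗ (c ⊗ h)) ⊜ (c ⊗ (a ⊕ x ⊗ h))) refl c a x (horner v x))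

  Monic⇒Deg<suc : ∀ {k f} → Monic k f → Deg< (suc k) f
  Monic⇒Deg<suc (v , f≗v) = v Vec.∷ʳ 1# , λ x → trans (f≗v x) (sym (horner-∷ʳ-1# v x))
    where
    horner-∷ʳ-1# : ∀ {k} (v : Vec F k) x → horner (v Vec.∷ʳ 1#) x ≡ hornerMonic v x
    horner-∷ʳ-1# []       x = trans (cong (1# +_) (zeroʳ x)) (+-identityʳ 1#)
    horner-∷ʳ-1# (c ∷ cs) x = cong (λ s → c + x · s) (horner-∷ʳ-1# cs x)

  Monic-1 : Monic 0 (λ _ → 1#)
  Monic-1 = [] , λ x → refl

  Monic-id : Monic 1 id
  Monic-id = (0# ∷ []) , λ x → sym (trans (+-identityˡ _) (*-identityʳ x))

  Monic-+ : ∀ {k f g} → Monic k f → Deg< k g → Monic k (λ x → f x + g x)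
  Monic-+ (u , f≗u) (v , g≗v) = Vec.zipWith _+_ u v , λ x → trans (cong₂ _+_ (f≗u x) (g≗v x)) (sym (hornerMonic-+ u v x))
    where
    hornerMonic-+ : ∀ {k} (u v : Vec F k) x → hornerMonic (Vec.zipWith _+_ u v) x ≡ hornerMonic u x + horner v x
    hornerMonic-+ []      []      x = sym (+-identityʳ 1#)
    hornerMonic-+ (a ∷ u) (b ∷ v) x = trans (cong (λ s → (a + b) + x · s) (hornerMonic-+ u v x))
      (solve 5 (λ a b x U V → ((a ⊕ b) ⊕ x ⊗ (U ⊕ V)) ⊜ ((a ⊕ x ⊗ U) ⊕ (b ⊕ x ⊗ V))) refl a b x (hornerMonic u x) (horner v x))

  Monic-shift : ∀ {k f} → Monic k f → Monic (suc k) (λ x → x · f x)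
  Monic-shift (v , f≗v) = (0# ∷ v) , λ x → trans (cong (x ·_) (f≗v x)) (sym (+-identityˡ _))

  Monic-· : ∀ {a b f g} → Monic a f → Monic b g → Monic (a ℕ.+ b) (λ x → f x · g x)
  Monic-· {b = b} {f} {g} (v , f≗v) Mg = Monic-ext (hornerMonic-· v) (λ x → cong (_· g x) (f≗v x))
    where
    hornerMonic-· : ∀ {a} (v : Vec F a) → Monic (a ℕ.+ b) (λ x → hornerMonic v x · g x)
    hornerMonic-· []       = Monic-ext Mg (λ x → *-identityˡ (g x))
    hornerMonic-· {suc a} (c ∷ cs) = Monic-ext
      (Monic-+ (Monic-shift (hornerMonic-· cs)) (Deg<-≤ (s≤s (ℕP.m≤n+m b a)) (Deg<-scale c (Monic⇒Deg<suc Mg))))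
      (λ x → trans (distribʳ (g x) c _) (trans (+-comm _ _) (cong (_+ c · g x) (*-assoc x _ (g x)))))

  Monic-pow : ∀ {a f} → Monic a f → ∀ k → Monic (a ℕ.* k) (λ x → pow (f x) k)
  Monic-pow {a}     Mf zero    = subst (λ d → Monic d (λ _ → 1#)) (sym (ℕP.*-zeroʳ a)) Monic-1
  Monic-pow {a} {f} Mf (suc k) = subst (λ d → Monic d (λ x → pow (f x) (suc k))) (sym (ℕP.*-suc a k)) (Monic-· Mf (Monic-pow Mf k))

  Monic-pow-id : ∀ k → Monic k (λ x → pow x k)
  Monic-pow-id k = subst (λ d → Monic d (λ x → pow x k)) (ℕP.*-identityˡ k) (Monic-pow Monic-id k)

  Tr-Deg< : ∀ r .{{_ : ℕ.NonZero r}} k → Deg< (2 ^ (r ℕ.* k)) (Tr r k)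
  Tr-Monic : ∀ r .{{_ : ℕ.NonZero r}} k → Monic (2 ^ (r ℕ.* k)) (Tr r (suc k))
  Tr-Deg< r zero    = Deg<-0 _
  Tr-Deg< r (suc k) = Deg<-≤ (ℕP.^-monoʳ-< 2 (s≤s (s≤s z≤n)) (ℕP.*-monoʳ-< r (ℕP.n<1+n k))) (Monic⇒Deg<suc (Tr-Monic r k))
  Tr-Monic r k = Monic-ext (Monic-+ (Monic-pow-id _) (Tr-Deg< r k)) (λ x → +-comm (Tr r k x) _)

  divide-linear : ∀ {d} (v : Vec F (suc d)) a →
                  Σ (Vec F d) λ w → Σ F λ ρ → ∀ x → hornerMonic v x ≡ (x - a) · hornerMonic w x + ρ
  divide-linear (c ∷ []) a = [] , c + a , λ x → begin
    c + x · 1#              ≡⟨ cong (c +_) (*-identityʳ x) ⟩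
    c + x                   ≡⟨ sym (+-identityʳ _) ⟩
    (c + x) + 0#            ≡⟨ cong ((c + x) +_) (sym (-‿inverseˡ a)) ⟩
    (c + x) + (- a + a)     ≡⟨ solve 4 (λ c x a⁻ a → ((c ⊕ x) ⊕ (a⁻ ⊕ a)) ⊜ ((x ⊕ a⁻) ⊕ (c ⊕ a))) refl c x (- a) a ⟩
    (x - a) + (c + a)       ≡⟨ cong (_+ (c + a)) (sym (*-identityʳ _)) ⟩
    (x - a) · 1# + (c + a)  ∎
  divide-linear (c ∷ c' ∷ cs) a with divide-linear (c' ∷ cs) a
  ... | w , ρ , v≗ = (ρ ∷ w) , c + a · ρ , λ x → begin
    c + x · hornerMonic (c' ∷ cs) x                        ≡⟨ cong (λ s → c + x · s) (v≗ x) ⟩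
    c + x · ((x - a) · hornerMonic w x + ρ)                ≡⟨ sym (+-identityʳ _) ⟩
    c + x · ((x - a) · hornerMonic w x + ρ) + 0#
      ≡⟨ cong (c + x · ((x - a) · hornerMonic w x + ρ) +_) (sym (trans (cong (_· ρ) (-‿inverseˡ a)) (zeroˡ ρ))) ⟩
    c + x · ((x - a) · hornerMonic w x + ρ) + (- a + a) · ρ
      ≡⟨ solve 6 (λ x a⁻ a c w ρ → (c ⊕ x ⊗ ((x ⊕ a⁻) ⊗ w ⊕ ρ) ⊕ (a⁻ ⊕ a) ⊗ ρ) ⊜ ((x ⊕ a⁻) ⊗ (ρ ⊕ x ⊗ w) ⊕ (c ⊕ a ⊗ ρ)))
                 refl x (- a) a c (hornerMonic w x) ρ ⟩
    (x - a) · (ρ + x · hornerMonic w x) + (c + a · ρ)      ∎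

  roots-bound : ∀ d (v : Vec F d) (xs : List F) → Unique xs → All (λ a → hornerMonic v a ≡ 0#) xs → length xs ≤ d
  roots-bound d       v  []       _            _           = z≤n
  roots-bound zero    [] (a ∷ xs) _            (1≡0 ∷ _)   = ⊥-elim (0≢1 (sym 1≡0))
  roots-bound (suc d) v  (a ∷ xs) (a∉xs ∷ !xs) (va≡0 ∷ vxs≡0) with divide-linear v a
  ... | w , ρ , v≗ = s≤s (roots-bound d w xs !xs (All.zipWith root-of-quotient (a∉xs , vxs≡0)))
    where
    ρ≡0 : ρ ≡ 0#
    ρ≡0 = begin
      ρ                               ≡⟨ sym (+-identityˡ ρ) ⟩
      0# + ρ                          ≡⟨ cong (_+ ρ) (sym (zeroˡ (hornerMonic w a))) ⟩
      0# · hornerMonic w a + ρ        ≡⟨ cong (λ s → s · hornerMonic w a + ρ) (sym (-‿inverseʳ a)) ⟩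
      (a - a) · hornerMonic w a + ρ   ≡⟨ sym (v≗ a) ⟩
      hornerMonic v a                 ≡⟨ va≡0 ⟩
      0#                              ∎
    root-of-quotient : ∀ {b} → a ≢ b × hornerMonic v b ≡ 0# → hornerMonic w b ≡ 0#
    root-of-quotient {b} (a≢b , vb≡0) with x·y≡0⇒x≡0⊎y≡0 (b - a) (hornerMonic w b) (begin
      (b - a) · hornerMonic w b        ≡⟨ sym (+-identityʳ _) ⟩
      (b - a) · hornerMonic w b + 0#   ≡⟨ cong (_ +_) (sym ρ≡0) ⟩
      (b - a) · hornerMonic w b + ρ    ≡⟨ sym (v≗ b) ⟩
      hornerMonic v b                  ≡⟨ vb≡0 ⟩
      0#                               ∎)
    ... | inj₁ b-a≡0 = ⊥-elim (a≢b (sym (x∙y⁻¹≈ε⇒x≈y b a b-a≡0)))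
    ... | inj₂ wb≡0  = wb≡0

  count-≤-degree : ∀ {P : Pred F 0ℓ} (P? : Decidable P) {d f} → Monic d f → (∀ {x} → P x → f x ≡ 0#) → count P? ≤ d
  count-≤-degree P? {d} (v , f≗v) P⇒root = subst (_≤ d) (LP.length-map e selected)
    (roots-bound d v (lmap e selected) unique
      (AllP.map⁺ (All.map (λ p → trans (sym (f≗v _)) (P⇒root p)) (AllP.all-filter (P? ∘ e) (allFin (2 ^ n))))))
    where
    selected = filter (P? ∘ e) (allFin (2 ^ n))
    e-injective : ∀ {i j} → e i ≡ e j → i ≡ j
    e-injective {i} {j} eq = trans (sym (ι∘e i)) (trans (cong ι eq) (ι∘e j))
    unique : Unique (lmap e selected)
    unique = UniqueP.map⁺ e-injective (UniqueP.filter⁺ (P? ∘ e) (UniqueP.allFin⁺ (2 ^ n)))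

  count-cong : ∀ {P Q : Pred F 0ℓ} (P? : Decidable P) (Q? : Decidable Q) → P ⊆ Q → Q ⊆ P → count P? ≡ count Q?
  count-cong P? Q? P⊆Q Q⊆P = cong length (LP.filter-≐ (P? ∘ e) (Q? ∘ e) (P⊆Q , Q⊆P) (allFin (2 ^ n)))

  2^n≤count+count : ∀ {P Q : Pred F 0ℓ} (P? : Decidable P) (Q? : Decidable Q) → (∀ x → P x ⊎ Q x) →
                    2 ^ n ≤ count P? ℕ.+ count Q?
  2^n≤count+count P? Q? P∪Q = subst (_≤ count P? ℕ.+ count Q?) (LP.length-tabulate id)
    (length≤filter+filter (P? ∘ e) (Q? ∘ e) (P∪Q ∘ e) (allFin (2 ^ n)))

  module CharacteristicTwo (1+1≡0 : 1# + 1# ≡ 0#) where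

    x+x≡0 : ∀ x → x + x ≡ 0#
    x+x≡0 x = begin
      x + x              ≡⟨ cong₂ _+_ (sym (*-identityʳ x)) (sym (*-identityʳ x)) ⟩
      x · 1# + x · 1#    ≡⟨ sym (distribˡ x 1# 1#) ⟩
      x · (1# + 1#)      ≡⟨ cong (x ·_) 1+1≡0 ⟩
      x · 0#             ≡⟨ zeroʳ x ⟩
      0#                 ∎

    x+[x+y]≡y : ∀ x y → x + (x + y) ≡ y
    x+[x+y]≡y x y = begin
      x + (x + y)   ≡⟨ sym (+-assoc x x y) ⟩
      (x + x) + y   ≡⟨ cong (_+ y) (x+x≡0 x) ⟩
      0# + y        ≡⟨ +-identityˡ y ⟩
      y             ∎

    x+y≡0⇒x≡y : ∀ {x y} → x + y ≡ 0# → x ≡ y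
    x+y≡0⇒x≡y {x} {y} x+y≡0 = begin
      x             ≡⟨ sym (x+[x+y]≡y y x) ⟩
      y + (y + x)   ≡⟨ cong (y +_) (trans (+-comm y x) x+y≡0) ⟩
      y + 0#        ≡⟨ +-identityʳ y ⟩
      y             ∎

    frobenius : ∀ k x y → pow (x + y) (2 ^ k) ≡ pow x (2 ^ k) + pow y (2 ^ k)
    frobenius zero x y = trans (pow-identityʳ _) (sym (cong₂ _+_ (pow-identityʳ x) (pow-identityʳ y)))
    frobenius (suc k) x y = begin
      pow (x + y) (2 ℕ.* 2 ^ k)                      ≡⟨ pow-* (x + y) 2 (2 ^ k) ⟩
      pow (pow (x + y) 2) (2 ^ k)                    ≡⟨ cong (λ z → pow z (2 ^ k)) square-+ ⟩
      pow (pow x 2 + pow y 2) (2 ^ k)                ≡⟨ frobenius k (pow x 2) (pow y 2) ⟩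
      pow (pow x 2) (2 ^ k) + pow (pow y 2) (2 ^ k)  ≡⟨ sym (cong₂ _+_ (pow-* x 2 (2 ^ k)) (pow-* y 2 (2 ^ k))) ⟩
      pow x (2 ℕ.* 2 ^ k) + pow y (2 ℕ.* 2 ^ k)      ∎
      where
      square-+ : pow (x + y) 2 ≡ pow x 2 + pow y 2
      square-+ = begin
        (x + y) · ((x + y) · 1#)           ≡⟨ cong ((x + y) ·_) (*-identityʳ _) ⟩
        (x + y) · (x + y)                  ≡⟨ solve 2 (λ x y → ((x ⊕ y) ⊗ (x ⊕ y)) ⊜ ((x ⊗ x ⊕ y ⊗ y) ⊕ (x ⊗ y ⊕ x ⊗ y))) refl x y ⟩
        (x · x + y · y) + (x · y + x · y)  ≡⟨ cong ((x · x + y · y) +_) (x+x≡0 (x · y)) ⟩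
        (x · x + y · y) + 0#               ≡⟨ +-identityʳ _ ⟩
        x · x + y · y                      ≡⟨ sym (cong₂ _+_ (cong (x ·_) (*-identityʳ x)) (cong (y ·_) (*-identityʳ y))) ⟩
        pow x 2 + pow y 2                  ∎

    frobenius-sumF : ∀ k d f → pow (sumF d f) (2 ^ k) ≡ sumF d (λ i → pow (f i) (2 ^ k))
    frobenius-sumF k zero    f = pow-0#-2^ k
    frobenius-sumF k (suc d) f = trans (frobenius k (sumF d f) (f d)) (cong (_+ pow (f d) (2 ^ k)) (frobenius-sumF k d f))

    sumF-telescope : ∀ (g : ℕ → F) d → sumF d (λ i → g (suc i) + g i) ≡ g d + g 0
    sumF-telescope g zero    = sym (x+x≡0 (g 0))
    sumF-telescope g (suc d) = begin
      sumF d (λ i → g (suc i) + g i) + (g (suc d) + g d)  ≡⟨ cong (_+ (g (suc d) + g d)) (sumF-telescope g d) ⟩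
      (g d + g 0) + (g (suc d) + g d)   ≡⟨ solve 3 (λ a b c → ((a ⊕ b) ⊕ (c ⊕ a)) ⊜ ((c ⊕ b) ⊕ (a ⊕ a))) refl (g d) (g 0) (g (suc d)) ⟩
      (g (suc d) + g 0) + (g d + g d)   ≡⟨ cong ((g (suc d) + g 0) +_) (x+x≡0 (g d)) ⟩
      (g (suc d) + g 0) + 0#            ≡⟨ +-identityʳ _ ⟩
      g (suc d) + g 0                   ∎

    sumF-frobenius-z²+z : ∀ z d → sumF d (λ k → pow (pow z 2 + z) (2 ^ k)) ≡ pow z (2 ^ d) + z
    sumF-frobenius-z²+z z d = begin
      sumF d (λ k → pow (pow z 2 + z) (2 ^ k))  ≡⟨ sumF-cong d (λ k → trans (frobenius k (pow z 2) z) (cong (_+ g k) (sym (pow-* z 2 (2 ^ k))))) ⟩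
      sumF d (λ k → g (suc k) + g k)            ≡⟨ sumF-telescope g d ⟩
      g d + g 0                                 ≡⟨ cong (g d +_) (pow-identityʳ z) ⟩
      pow z (2 ^ d) + z                         ∎
      where
      g : ℕ → F
      g k = pow z (2 ^ k)

    module _ (r : ℕ) where

      Tr-+ : ∀ t a b → Tr r t (a + b) ≡ Tr r t a + Tr r t b
      Tr-+ t a b = trans (sumF-cong t (λ i → frobenius (r ℕ.* i) a b)) (sumF-distrib-+ t _ _)

      Tr-0# : ∀ t → Tr r t 0# ≡ 0#
      Tr-0# t = trans (sumF-cong t (λ i → pow-0#-2^ (r ℕ.* i))) (sumF-zero t)

      Tr-sumF : ∀ t d f → Tr r t (sumF d f) ≡ sumF d (λ k → Tr r t (f k))
      Tr-sumF t zero    f = Tr-0# t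
      Tr-sumF t (suc d) f = trans (Tr-+ t (sumF d f) (f d)) (cong (_+ Tr r t (f d)) (Tr-sumF t d f))

      Tr-pow-2^ : ∀ t k x → Tr r t (pow x (2 ^ k)) ≡ pow (Tr r t x) (2 ^ k)
      Tr-pow-2^ t k x = trans (sumF-cong t (λ i → pow-comm x (2 ^ k) (2 ^ (r ℕ.* i)))) (sym (frobenius-sumF k t _))

      Tr-·-InSub : ∀ t c {b} → InSub r b → Tr r t (c · b) ≡ Tr r t c · b
      Tr-·-InSub t c {b} b∈ = trans
        (sumF-cong t (λ i → trans (pow-distrib-· c b (2 ^ (r ℕ.* i))) (cong (pow c (2 ^ (r ℕ.* i)) ·_) (InSub-pow-2^-multiple {r} b∈ i))))
        (sumF-distribʳ-· t _ b)

      -- Tr(x)^(2^r) is the trace sum shifted by one, so the sum telescopes.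
      Tr-artinSchreier : ∀ t x → pow (Tr r t x) (2 ^ r) + Tr r t x ≡ pow x (2 ^ (r ℕ.* t)) + x
      Tr-artinSchreier t x = begin
        pow (Tr r t x) (2 ^ r) + Tr r t x                       ≡⟨ cong (_+ Tr r t x) (frobenius-sumF r t _) ⟩
        sumF t (λ i → pow (g i) (2 ^ r)) + sumF t g             ≡⟨ cong (_+ Tr r t x) (sumF-cong t g-shift) ⟩
        sumF t (λ i → g (suc i)) + sumF t g                     ≡⟨ sym (sumF-distrib-+ t (λ i → g (suc i)) g) ⟩
        sumF t (λ i → g (suc i) + g i)                          ≡⟨ sumF-telescope g t ⟩
        g t + g 0                                               ≡⟨ cong (g t +_) (trans (cong (λ k → pow x (2 ^ k)) (ℕP.*-zeroʳ r)) (pow-identityʳ x)) ⟩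
        pow x (2 ^ (r ℕ.* t)) + x                               ∎
        where
        g : ℕ → F
        g i = pow x (2 ^ (r ℕ.* i))
        g-shift : ∀ i → pow (g i) (2 ^ r) ≡ g (suc i)
        g-shift i = trans (pow-2^-2^ x (r ℕ.* i) r) (cong (λ k → pow x (2 ^ k)) (trans (ℕP.+-comm (r ℕ.* i) r) (sym (ℕP.*-suc r i))))

      Tr[z²+z]≡0⇒z^2^rt+z≡0 : ∀ t z → Tr r t (pow z 2 + z) ≡ 0# → pow z (2 ^ (r ℕ.* t)) + z ≡ 0#
      Tr[z²+z]≡0⇒z^2^rt+z≡0 t z Tr≡0 = begin
        pow z (2 ^ (r ℕ.* t)) + z                              ≡⟨ sym (Tr-artinSchreier t z) ⟩
        pow (Tr r t z) (2 ^ r) + Tr r t z                      ≡⟨ cong (_+ Tr r t z) (sym (Tr-pow-2^ t r z)) ⟩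
        Tr r t (pow z (2 ^ r)) + Tr r t z                      ≡⟨ sym (Tr-+ t (pow z (2 ^ r)) z) ⟩
        Tr r t (pow z (2 ^ r) + z)                             ≡⟨ cong (Tr r t) (sym (sumF-frobenius-z²+z z r)) ⟩
        Tr r t (sumF r (λ k → pow (pow z 2 + z) (2 ^ k)))      ≡⟨ Tr-sumF t r _ ⟩
        sumF r (λ k → Tr r t (pow (pow z 2 + z) (2 ^ k)))
          ≡⟨ sumF-cong r (λ k → trans (Tr-pow-2^ t k _) (trans (cong (λ s → pow s (2 ^ k)) Tr≡0) (pow-0#-2^ k))) ⟩
        sumF r (λ _ → 0#)                                      ≡⟨ sumF-zero r ⟩
        0#                                                     ∎

    -- S is the kernel of the trace

    module _ (t r : ℕ) where
      private
        q : ℕ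
        q = 2 ^ (t * r)

        T : F → F
        T = Tr r t

      2^rt≡q : 2 ^ (r ℕ.* t) ≡ q
      2^rt≡q = cong (2 ^_) (ℕP.*-comm r t)

      x^q≡x⇒x^[q+1]≡x² : ∀ {x} → pow x q ≡ x → pow x (q ℕ.+ 1) ≡ pow x 2
      x^q≡x⇒x^[q+1]≡x² {x} x^q≡x = trans (pow-+ x q 1) (cong (_· pow x 1) x^q≡x)

      Tr≡0⇒InS : ∀ {x} → T x ≡ 0# → InS K t r x
      Tr≡0⇒InS {x} T≡0 = Tr[x^[q+1]]≡0 , x+x^q∈
        where
        x^q+x≡0 : pow x q + x ≡ 0#
        x^q+x≡0 = begin
          pow x q + x                 ≡⟨ cong (λ k → pow x k + x) (sym 2^rt≡q) ⟩
          pow x (2 ^ (r ℕ.* t)) + x   ≡⟨ sym (Tr-artinSchreier r t x) ⟩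
          pow (T x) (2 ^ r) + T x     ≡⟨ cong (λ s → pow s (2 ^ r) + s) T≡0 ⟩
          pow 0# (2 ^ r) + 0#         ≡⟨ trans (+-identityʳ _) (pow-0#-2^ r) ⟩
          0#                          ∎
        x+x^q≡0 : x + pow x q ≡ 0#
        x+x^q≡0 = trans (+-comm x _) x^q+x≡0
        Tr[x^[q+1]]≡0 : T (pow x (q ℕ.+ 1)) ≡ 0#
        Tr[x^[q+1]]≡0 = begin
          T (pow x (q ℕ.+ 1))  ≡⟨ cong T (x^q≡x⇒x^[q+1]≡x² (x+y≡0⇒x≡y x^q+x≡0)) ⟩
          T (pow x 2)          ≡⟨ Tr-pow-2^ r t 1 x ⟩
          pow (T x) 2          ≡⟨ cong (λ s → pow s 2) T≡0 ⟩
          pow 0# 2             ≡⟨ pow-0#-2^ 1 ⟩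
          0#                   ∎
        x+x^q∈ : InSub r (x + pow x q)
        x+x^q∈ = trans (cong (λ s → pow s (2 ^ r)) x+x^q≡0) (trans (pow-0#-2^ r) (sym x+x^q≡0))

      InS⇒x+x^q≡0 : ∀ {x} → InS K t r x → x + pow x q ≡ 0#
      InS⇒x+x^q≡0 {x} (Tr[x^[q+1]]≡0 , y∈) with (x + pow x q) ≟ 0#
      ... | yes y≡0 = y≡0
      ... | no  y≢0 = ⊥-elim (0≢1 (sym 1≡0))
        where
        y = x + pow x q
        y⁻¹ = inv y y≢0
        z = x · y⁻¹
        y⁻¹∈ : InSub r y⁻¹
        y⁻¹∈ = InSub-inv {r} y≢0 y∈
        x^q≡x+y : pow x q ≡ x + y
        x^q≡x+y = sym (x+[x+y]≡y x (pow x q))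
        x^[q+1]/y²≡z²+z : pow x (q ℕ.+ 1) · (y⁻¹ · y⁻¹) ≡ pow z 2 + z
        x^[q+1]/y²≡z²+z = begin
          pow x (q ℕ.+ 1) · (y⁻¹ · y⁻¹)  ≡⟨ cong (_· (y⁻¹ · y⁻¹)) (trans (pow-+ x q 1) (cong₂ _·_ x^q≡x+y (pow-identityʳ x))) ⟩
          ((x + y) · x) · (y⁻¹ · y⁻¹)
            ≡⟨ solve 3 (λ x y w → (((x ⊕ y) ⊗ x) ⊗ (w ⊗ w)) ⊜ ((x ⊗ w) ⊗ (x ⊗ w) ⊕ (y ⊗ w) ⊗ (x ⊗ w))) refl x y y⁻¹ ⟩
          z · z + (y · y⁻¹) · z
            ≡⟨ cong₂ _+_ (cong (z ·_) (sym (pow-identityʳ z))) (trans (cong (_· z) (·-inverseʳ y y≢0)) (*-identityˡ z)) ⟩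
          pow z 2 + z                    ∎
        Tr[z²+z]≡0 : T (pow z 2 + z) ≡ 0#
        Tr[z²+z]≡0 = begin
          T (pow z 2 + z)                          ≡⟨ cong T (sym x^[q+1]/y²≡z²+z) ⟩
          T (pow x (q ℕ.+ 1) · (y⁻¹ · y⁻¹))        ≡⟨ Tr-·-InSub r t _ (InSub-· {r} y⁻¹∈ y⁻¹∈) ⟩
          T (pow x (q ℕ.+ 1)) · (y⁻¹ · y⁻¹)        ≡⟨ cong (_· (y⁻¹ · y⁻¹)) Tr[x^[q+1]]≡0 ⟩
          0# · (y⁻¹ · y⁻¹)                         ≡⟨ zeroˡ _ ⟩
          0#                                       ∎
        z^q≡z+1 : pow z q ≡ z + 1#
        z^q≡z+1 = begin
          pow z q                  ≡⟨ pow-distrib-· x y⁻¹ q ⟩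
          pow x q · pow y⁻¹ q      ≡⟨ cong₂ _·_ x^q≡x+y (subst (λ k → pow y⁻¹ k ≡ y⁻¹) 2^rt≡q (InSub-pow-2^-multiple {r} y⁻¹∈ t)) ⟩
          (x + y) · y⁻¹            ≡⟨ distribʳ y⁻¹ x y ⟩
          z + y · y⁻¹              ≡⟨ cong (z +_) (·-inverseʳ y y≢0) ⟩
          z + 1#                   ∎
        1≡0 : 1# ≡ 0#
        1≡0 = begin
          1#                          ≡⟨ sym (x+[x+y]≡y z 1#) ⟩
          z + (z + 1#)                ≡⟨ trans (+-comm z _) (cong (_+ z) (sym z^q≡z+1)) ⟩
          pow z q + z                 ≡⟨ cong (λ k → pow z k + z) (sym 2^rt≡q) ⟩
          pow z (2 ^ (r ℕ.* t)) + z   ≡⟨ Tr[z²+z]≡0⇒z^2^rt+z≡0 r t z Tr[z²+z]≡0 ⟩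
          0#                          ∎

      InS⇒Tr≡0 : ∀ {x} → InS K t r x → T x ≡ 0#
      InS⇒Tr≡0 {x} x∈S@(Tr[x^[q+1]]≡0 , _) = pow-2≡0⇒≡0 (begin
        pow (T x) 2           ≡⟨ sym (Tr-pow-2^ r t 1 x) ⟩
        T (pow x 2)           ≡⟨ cong T (sym (x^q≡x⇒x^[q+1]≡x² (sym (x+y≡0⇒x≡y (InS⇒x+x^q≡0 x∈S))))) ⟩
        T (pow x (q ℕ.+ 1))   ≡⟨ Tr[x^[q+1]]≡0 ⟩
        0#                    ∎)

  module TraceKernel (t' r' : ℕ) (n≡ : n ≡ 2 * (suc t' * suc r')) where
    open CharacteristicTwo (characteristic-two n≡)

    private
      t r q E : ℕ
      t = suc t'
      r = suc r'
      q = 2 ^ (t * r)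
      E = 2 ^ (r * t')

      T : F → F
      T = Tr r t

      ℘ : F → F
      ℘ x = pow x q + x

      -- chosen so that T · H = ℘ ∘ ℘
      H : F → F
      H x = (pow (T x) (pred (2 ^ r)) + 1#) · (pow (℘ x) (pred q) + 1#)

      q·q≡2^n : q * q ≡ 2 ^ n
      q·q≡2^n = trans (sym (ℕP.^-distribˡ-+-* 2 (t * r) (t * r)))
                      (cong (2 ^_) (trans (cong (t * r ℕ.+_) (sym (ℕP.+-identityʳ (t * r)))) (sym n≡)))

      2^n≡E+degH : 2 ^ n ≡ E ℕ.+ (E * pred (2 ^ r) ℕ.+ q * pred q)
      2^n≡E+degH = begin
        2 ^ n                                      ≡⟨ sym q·q≡2^n ⟩
        q * q                                      ≡⟨ cong (q *_) (sym (ℕP.suc-pred q {{ℕP.m^n≢0 2 (t * r)}})) ⟩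
        q * suc (pred q)                           ≡⟨ ℕP.*-suc q (pred q) ⟩
        q ℕ.+ q * pred q                           ≡⟨ cong (ℕ._+ q * pred q) q≡E·suc[pred[2^r]] ⟩
        E * suc (pred (2 ^ r)) ℕ.+ q * pred q      ≡⟨ cong (ℕ._+ q * pred q) (ℕP.*-suc E (pred (2 ^ r))) ⟩
        (E ℕ.+ E * pred (2 ^ r)) ℕ.+ q * pred q    ≡⟨ ℕP.+-assoc E _ _ ⟩
        E ℕ.+ (E * pred (2 ^ r) ℕ.+ q * pred q)    ∎
        where
        q≡E·suc[pred[2^r]] : q ≡ E * suc (pred (2 ^ r))
        q≡E·suc[pred[2^r]] = begin
          2 ^ (r ℕ.+ t' * r)          ≡⟨ ℕP.^-distribˡ-+-* 2 r (t' * r) ⟩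
          2 ^ r * 2 ^ (t' * r)        ≡⟨ ℕP.*-comm (2 ^ r) _ ⟩
          2 ^ (t' * r) * 2 ^ r        ≡⟨ cong₂ (λ a b → 2 ^ a * b) (ℕP.*-comm t' r) (sym (ℕP.suc-pred (2 ^ r) {{ℕP.m^n≢0 2 r}})) ⟩
          E * suc (pred (2 ^ r))      ∎

      ℘-Monic : Monic q ℘
      ℘-Monic = Monic-+ (Monic-pow-id q) (Deg<-≤ (ℕP.^-monoʳ-≤ 2 {1} {t * r} (s≤s z≤n)) Deg<-id)

      H-Monic : Monic (E * pred (2 ^ r) ℕ.+ q * pred q) H
      H-Monic = Monic-·
        (Monic-+ (Monic-pow (Tr-Monic r t') _) (Deg<-≤ (ℕP.*-mono-≤ (ℕP.m^n>0 2 (r * t')) (1≤pred[2^k] {r} (s≤s z≤n))) (Deg<-const 1#)))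
        (Monic-+ (Monic-pow ℘-Monic _) (Deg<-≤ (ℕP.*-mono-≤ (ℕP.m^n>0 2 (t * r)) (1≤pred[2^k] {t * r} (s≤s z≤n))) (Deg<-const 1#)))

      ℘-fixed : ∀ x → pow (℘ x) q ≡ ℘ x
      ℘-fixed x = begin
        pow (pow x q + x) q            ≡⟨ frobenius (t * r) (pow x q) x ⟩
        pow (pow x q) q + pow x q      ≡⟨ cong (_+ pow x q) (trans (sym (pow-* x q q)) (trans (cong (pow x) q·q≡2^n) (fermat x))) ⟩
        x + pow x q                    ≡⟨ +-comm x _ ⟩
        pow x q + x                    ∎

      Tr·H≡0 : ∀ x → T x · H x ≡ 0#
      Tr·H≡0 x = begin
        T x · (h₁ · h₂)           ≡⟨ sym (*-assoc _ h₁ h₂) ⟩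
        (T x · h₁) · h₂           ≡⟨ cong (_· h₂) (a·[a^pred[2^k]+1]≡a^2^k+a r (T x)) ⟩
        (pow (T x) (2 ^ r) + T x) · h₂ ≡⟨ cong (_· h₂) (trans (Tr-artinSchreier r t x) (cong (λ k → pow x k + x) (2^rt≡q t r))) ⟩
        ℘ x · h₂                  ≡⟨ a·[a^pred[2^k]+1]≡a^2^k+a (t * r) (℘ x) ⟩
        pow (℘ x) q + ℘ x         ≡⟨ cong (_+ ℘ x) (℘-fixed x) ⟩
        ℘ x + ℘ x                 ≡⟨ x+x≡0 (℘ x) ⟩
        0#                        ∎
        where
        h₁ = pow (T x) (pred (2 ^ r)) + 1#
        h₂ = pow (℘ x) (pred q) + 1#

    count-Tr≡0 : count (λ x → Tr r t x ≟ 0#) ≡ 2 ^ (r * t')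
    count-Tr≡0 = ℕP.≤-antisym (count-≤-degree (λ x → T x ≟ 0#) (Tr-Monic r t') id) E≤count
      where
      E≤count : E ≤ count (λ x → T x ≟ 0#)
      E≤count = ℕP.+-cancelʳ-≤ degH E _ (subst (_≤ count (λ x → T x ≟ 0#) ℕ.+ degH) 2^n≡E+degH (ℕP.≤-trans
        (2^n≤count+count (λ x → T x ≟ 0#) (λ x → H x ≟ 0#) (λ x → x·y≡0⇒x≡0⊎y≡0 _ _ (Tr·H≡0 x)))
        (ℕP.+-monoʳ-≤ _ (count-≤-degree (λ x → H x ≟ 0#) H-Monic id))))
        where
        degH = E * pred (2 ^ r) ℕ.+ q * pred q

lemma9 : (t r : ℕ) → 1 ≤ t → 1 ≤ r →
    (K : GF2^ (2 * (t * r))) →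
    GF2^.count K (InS? K t r) ≡ 2 ^ (t * r ∸ r)
lemma9 t@(suc t') r@(suc r') _ _ K = begin
  count (InS? K t r)            ≡⟨ count-cong (InS? K t r) (λ x → Tr r t x ≟ 0#) (InS⇒Tr≡0 t r) (Tr≡0⇒InS t r) ⟩
  count (λ x → Tr r t x ≟ 0#)   ≡⟨ count-Tr≡0 ⟩
  2 ^ (r * t')                  ≡⟨ cong (2 ^_) (trans (ℕP.*-comm r t') (sym (ℕP.m+n∸m≡n r (t' * r)))) ⟩
  2 ^ (t * r ∸ r)               ∎
  where
  open GF2^ K using (count; Tr; _≟_; 0#)
  open FiniteField K
  open CharacteristicTwo (characteristic-two refl)
  open TraceKernel t' r' refl
  open ≡-Reasoning
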